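{- Let $\mathcal{M}$ be a concurrent game model, $q_{in}$ a state of $\mathcal{M}$ and $\varphi$ an ATL-formula. Then $\mathcal{M},q_{in}\models_f\varphi$ if and only if $\mathcal{M},q_{in}\models^g_f\varphi$.
   Context: A concurrent game model (CGM) is $\mathcal{M}=(\mathrm{Agt},\mathrm{St},\Pi,\mathrm{Act},d,o,v)$: $\mathrm{Agt}=\{1,\dots,k\}$ agents; nonempty sets $\mathrm{St}$ (states), $\Pi$ (proposition symbols), $\mathrm{Act}$ (actions); $d:\mathrm{Agt}\times\mathrm{St}\to\mathcal{P}(\mathrm{Act})\setminus\{\emptyset\}$; $o$ assigns to each state $q$ and each action profile $\vec\alpha=(\alpha_1,\dots,\alpha_k)$ with $\alpha_i\in d(i,q)$ an outcome state $o(q,\vec\alpha)$; $v:\Pi\to\mathcal{P}(\mathrm{St})$. For $A\subseteq\mathrm{Agt}$, $\overline{A}=\mathrm{Agt}\setminus A$ and $\mathrm{action}(A,q)$ is the set of tuples $(\alpha_i)_{i\in A}$ with $\alpha_i\in d(i,q)$. A (positional) strategy for agent $a$ is $s_a:\mathrm{St}\to\mathrm{Act}$ with $s_a(q)\in d(a,q)$; a collective strategy $S_A$ is a tuple of strategies, one for each $a\in A$; $\mathrm{paths}(q,S_A)$ is the set of infinite sequences $\Lambda$ of states with $\Lambda[0]=q$ and $\Lambda[n+1]=o(\Lambda[n],\vec\alpha)$ for some action profile $\vec\alpha$ at $\Lambda[n]$ in which every $a\in A$ plays $s_a(\Lambda[n])$. ATL formulae: $\varphi::=p\mid\neg\varphi\mid(\varphi\vee\varphi)\mid\langle\!\langle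 A\rangle\!\rangle\mathsf{X}\varphi\mid\langle\!\langle A\rangle\!\rangle\varphi\,\mathsf{U}\,\varphi\mid\langle\!\langle A\rangle\!\rangle\varphi\,\mathsf{R}\,\varphi$. Finitely bounded compositional semantics $\models_f$: $q\models_f p$ iff $q\in v(p)$; $\neg,\vee$ as usual; $q\models_f\langle\!\langle A\rangle\!\rangle\mathsf{X}\psi$ iff some $S_A$ has $\Lambda[1]\models_f\psi$ for all $\Lambda\in\mathrm{paths}(q,S_A)$; $q\models_f\langle\!\langle A\rangle\!\rangle\psi\mathsf{U}\theta$ iff there exist $n<\omega$ and $S_A$ such that for every $\Lambda\in\mathrm{paths}(q,S_A)$ there is $i\leq n$ with $\Lambda[i]\models_f\theta$ and $\Lambda[j]\models_f\psi$ for all $j<i$; $q\models_f\langle\!\langle A\rangle\!\rangle\psi\mathsf{R}\theta$ iff for every $n<\omega$ there is $S_{A,n}$ such that for every $\Lambda\in\mathrm{paths}(q,S_{A,n})$ and $i\leq n$, $\Lambda[i]\models_f\theta$ or $\Lambda[j]\models_f\psi$ for some $j<i$. Players: Eloise $\mathbf{E}$, Abelard $\mathbf{A}$; $\overline{\mathbf{P}}$ is the opponent of $\mathbf{P}$. One step game $\mathrm{step}(\mathbf{P},A,q)$: $\mathbf{P}$ picks a tuple in $\mathrm{action}(A,q)$, then $\overline{\mathbf{P}}$ picks a tuple in $\mathrm{action}(\overline{A},q)$; the resulting state is the outcome. Finitely bounded evaluation game $\mathcal{G}(\mathcal{M},q_{in},\varphi,\omega)$: positions $(\mathbf{P},q,\psi)$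 with $\psi$ a subformula of $\varphi$; start $(\mathbf{E},q_{in},\varphi)$. At $(\mathbf{P},q,p)$ the game ends, $\mathbf{P}$ wins iff $q\in v(p)$, else $\overline{\mathbf{P}}$ wins. $(\mathbf{P},q,\neg\psi)\to(\overline{\mathbf{P}},q,\psi)$. At $(\mathbf{P},q,\psi\vee\theta)$, $\mathbf{P}$ chooses $(\mathbf{P},q,\psi)$ or $(\mathbf{P},q,\theta)$. At $(\mathbf{P},q,\langle\!\langle A\rangle\!\rangle\mathsf{X}\psi)$, $\mathrm{step}(\mathbf{P},A,q)$ gives $q'$, next $(\mathbf{P},q',\psi)$. At $(\mathbf{P},q,\langle\!\langle A\rangle\!\rangle\psi\mathsf{U}\theta)$ the embedded game $\mathbf{g}(\mathbf{P},\mathbf{P},A,q,\theta,\psi)$ is played; at $(\mathbf{P},q,\langle\!\langle A\rangle\!\rangle\psi\mathsf{R}\theta)$ the embedded game $\mathbf{g}(\mathbf{P},\overline{\mathbf{P}},A,q,\theta,\psi)$. In an embedded game $\mathbf{g}(\mathbf{V},\mathbf{C},A,q_0,\psi_{\mathbf{C}},\psi_{\overline{\mathbf{C}}})$ (verifier $\mathbf{V}$, controller $\mathbf{C}$), $\mathbf{C}$ first chooses a natural number $n$; play goes through configurations $(m,q)$ from $(n,q_0)$ with rules in order: (i) if $m=0$ end at exit position $(\mathbf{V},q,\psi_{\mathbf{C}})$; (ii) $\mathbf{C}$ may end at $(\mathbf{V},q,\psi_{\mathbf{C}})$; (iii) $\overline{\mathbf{C}}$ may end at $(\mathbf{V},q,\psi_{\overline{\mathbf{C}}})$;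 (iv) otherwise $\mathrm{step}(\mathbf{V},A,q)$ gives $q'$, continue from $(m-1,q')$. The evaluation game continues from the exit position. Strategies specify disjunct choices, action tuples (as verifier) or response functions $\mathrm{action}(A,q)\to\mathrm{action}(\overline{A},q)$ (as falsifier) in one step games, and at until/release positions: for the controller, a time limit $n<\omega$ and an embedded strategy; for the non-controller, for each $n<\omega$ an embedded strategy; embedded strategies are functions of configurations $(m,q)$ giving "end the game" (as permitted by the role) or an action tuple / response function. $\mathcal{M},q\models^g_f\varphi$ iff $\mathbf{E}$ has a strategy winning all consistent plays of $\mathcal{G}(\mathcal{M},q,\varphi,\omega)$. -}

module Defs where

open import Data.Nat using (ℕ; zero; suc; _≤_; _<_)
open import Data.Fin using (Fin)
open import Data.Fin.Subset using (Subset; _∈_; _∉_; ∁)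
open import Data.Fin.Subset.Properties using (_∈?_; x∉p⇒x∈∁p)
open import Data.Bool using (Bool; true; false; if_then_else_)
open import Data.Maybe using (Maybe; nothing; just; maybe′)
open import Data.Product using (Σ; _×_; _,_; proj₁; proj₂)
open import Data.Sum using (_⊎_)
open import Relation.Nullary using (¬_; yes; no)
open import Relation.Binary.PropositionalEquality using (_≡_)

-- The outcome function is total on Fin k → Act; only its values on
-- legal profiles (αᵢ ∈ d(i,q)) are ever used.

record CGM : Set₁ where
  field
    k    : ℕ
    St   : Set
    Ap   : Set
    Act  : Set
    d    : Fin k → St → Act → Set
    d-ne : (a : Fin k) (q : St) → Σ Act (d a q)
    o    : St → (Fin k → Act) → St
    v    : Ap → St → Set

infixr 5 _∨'_
data Fml (k : ℕ) (Π : Set) : Set where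
  atom   : Π → Fml k Π
  ¬'_    : Fml k Π → Fml k Π
  _∨'_   : Fml k Π → Fml k Π → Fml k Π
  ⟪_⟫X_  : Subset k → Fml k Π → Fml k Π
  ⟪_⟫_U_ : Subset k → Fml k Π → Fml k Π → Fml k Π
  ⟪_⟫_R_ : Subset k → Fml k Π → Fml k Π → Fml k Π

data Player : Set where
  E A : Player

opp : Player → Player
opp E = A
opp A = E

isE : Player → Bool
isE E = true
isE A = false

module _ (M : CGM) where
  open CGM M

  Formula : Set
  Formula = Fml k Ap

  Tuple : Subset k → St → Set
  Tuple B q = (i : Fin k) → i ∈ B → Σ Act (d i q)

  merge : (B : Subset k) (q : St) → Tuple B q → Tuple (∁ B) q → Fin k → Act
  merge B q α β i with i ∈? B
  ... | yes i∈B = proj₁ (α i i∈B)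
  ... | no  i∉B = proj₁ (β i (x∉p⇒x∈∁p i∉B))

  CStrat : Subset k → Set
  CStrat B = (i : Fin k) → i ∈ B → (q : St) → Σ Act (d i q)

  atState : {B : Subset k} → CStrat B → (q : St) → Tuple B q
  atState S q i i∈B = S i i∈B q

  IsPath : {B : Subset k} → St → CStrat B → (ℕ → St) → Set
  IsPath {B} q S Λ =
    (Λ 0 ≡ q) ×
    ((n : ℕ) → Σ (Tuple (∁ B) (Λ n)) λ β →
       Λ (suc n) ≡ o (Λ n) (merge B (Λ n) (atState S (Λ n)) β))

  Sat : St → Formula → Set
  Sat q (atom p) = v p q
  Sat q (¬' φ) = ¬ Sat q φ
  Sat q (φ ∨' ψ) = Sat q φ ⊎ Sat q ψ
  Sat q (⟪ B ⟫X φ) =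
    Σ (CStrat B) λ S → (Λ : ℕ → St) → IsPath q S Λ → Sat (Λ 1) φ
  Sat q (⟪ B ⟫ ψ U θ) =
    Σ ℕ λ n → Σ (CStrat B) λ S → (Λ : ℕ → St) → IsPath q S Λ →
      Σ ℕ λ i → (i ≤ n) × Sat (Λ i) θ × ((j : ℕ) → j < i → Sat (Λ j) ψ)
  Sat q (⟪ B ⟫ ψ R θ) =
    (n : ℕ) → Σ (CStrat B) λ S → (Λ : ℕ → St) → IsPath q S Λ →
      (i : ℕ) → i ≤ n → Sat (Λ i) θ ⊎ (Σ ℕ λ j → (j < i) × Sat (Λ j) ψ)

  -- Finitely bounded evaluation game, from Eloise's point of view.

  -- Eloise's move in step(P,B,q): as verifier (mine = true) a tuple in
  -- action(B,q); as falsifier a response function action(B,q) → action(B̄,q).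
  StepMove : Bool → Subset k → St → Set
  StepMove true  B q = Tuple B q
  StepMove false B q = Tuple B q → Tuple (∁ B) q

  StepAll : (mine : Bool) (B : Subset k) (q : St) → StepMove mine B q →
            (St → Set) → Set
  StepAll true  B q α K = (β : Tuple (∁ B) q) → K (o q (merge B q α β))
  StepAll false B q f K = (α : Tuple B q) → K (o q (merge B q α (f α)))

  -- embedded strategy: configuration (m,q) ↦ "end the game" (nothing)
  -- or a step-game move
  EmbStrat : Bool → Subset k → Set
  EmbStrat mine B = (m : ℕ) → (q : St) → Maybe (StepMove mine B q)

  -- Eloise's choice at a position (P,q,ψ); mine = (P is Eloise)
  Choice : Bool → St → Formula → Set
  Choice _     q (atom p) = Bool      -- irrelevant (no choice)
  Choice _     q (¬' φ) = Bool        -- irrelevant (no choice)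
  Choice true  q (φ ∨' ψ) = Bool      -- true = left disjunct
  Choice false q (φ ∨' ψ) = Bool      -- irrelevant (Abelard chooses)
  Choice mine  q (⟪ B ⟫X φ) = StepMove mine B q
  -- until: controller = verifier
  Choice true  q (⟪ B ⟫ ψ U θ) = ℕ × EmbStrat true B
  Choice false q (⟪ B ⟫ ψ U θ) = ℕ → EmbStrat false B
  -- release: controller = falsifier
  Choice true  q (⟪ B ⟫ ψ R θ) = ℕ → EmbStrat true B
  Choice false q (⟪ B ⟫ ψ R θ) = ℕ × EmbStrat false B

  EStrat : Set
  EStrat = (P : Player) (q : St) (φ : Formula) → Choice (isE P) q φ

  -- Eloise wins all plays of the embedded game from configuration (m,q)
  -- consistent with her embedded strategy s, where Kc / Kn say that she
  -- wins from the exit positions (V,q,ψ_C) / (V,q,ψ_C̄).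
  -- ctrl = Eloise is the controller; mine = Eloise is the verifier.
  EmbWin : (ctrl mine : Bool) (B : Subset k) → EmbStrat mine B →
           (Kc Kn : St → Set) → ℕ → St → Set
  EmbWin ctrl  mine B s Kc Kn zero q = Kc q
  EmbWin true  mine B s Kc Kn (suc m) q =
    maybe′ (λ mv → Kn q × StepAll mine B q mv (EmbWin true mine B s Kc Kn m))
           (Kc q) (s (suc m) q)
  EmbWin false mine B s Kc Kn (suc m) q =
    Kc q ×
    maybe′ (λ mv → StepAll mine B q mv (EmbWin false mine B s Kc Kn m))
           (Kn q) (s (suc m) q)

  EWins : EStrat → Player → St → Formula → Set
  EWins σ E q (atom p) = v p q
  EWins σ A q (atom p) = ¬ v p q
  EWins σ P q (¬' φ) = EWins σ (opp P) q φ
  EWins σ E q (φ ∨' ψ) =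
    if σ E q (φ ∨' ψ) then EWins σ E q φ else EWins σ E q ψ
  EWins σ A q (φ ∨' ψ) = EWins σ A q φ × EWins σ A q ψ
  EWins σ P q (⟪ B ⟫X φ) =
    StepAll (isE P) B q (σ P q (⟪ B ⟫X φ)) (λ q′ → EWins σ P q′ φ)
  EWins σ E q (⟪ B ⟫ ψ U θ) =
    EmbWin true true B (proj₂ (σ E q (⟪ B ⟫ ψ U θ)))
      (λ q′ → EWins σ E q′ θ) (λ q′ → EWins σ E q′ ψ)
      (proj₁ (σ E q (⟪ B ⟫ ψ U θ))) q
  EWins σ A q (⟪ B ⟫ ψ U θ) =
    (n : ℕ) → EmbWin false false B (σ A q (⟪ B ⟫ ψ U θ) n)
      (λ q′ → EWins σ A q′ θ) (λ q′ → EWins σ A q′ ψ) n q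
  EWins σ E q (⟪ B ⟫ ψ R θ) =
    (n : ℕ) → EmbWin false true B (σ E q (⟪ B ⟫ ψ R θ) n)
      (λ q′ → EWins σ E q′ θ) (λ q′ → EWins σ E q′ ψ) n q
  EWins σ A q (⟪ B ⟫ ψ R θ) =
    EmbWin true false B (proj₂ (σ A q (⟪ B ⟫ ψ R θ)))
      (λ q′ → EWins σ A q′ θ) (λ q′ → EWins σ A q′ ψ)
      (proj₁ (σ A q (⟪ B ⟫ ψ R θ))) q

  GSat : St → Formula → Set
  GSat q φ = Σ EStrat λ σ → EWins σ E q φ

-- Both semantics are characterised by the same finite approximants: the
-- bounded attractor (the coalition can force θ within m steps while staying
-- in ψ) and the bounded safety set (θ can be kept for m steps unless ψ
-- releases it). Classically a single positional strategy realises every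
-- approximant at once, by playing at each state the move of its least
-- attractor rank, resp. of its greatest safety rank below the bound; and
-- Eloise wins an embedded game from configuration (m, q) exactly when q lies
-- in the m-th approximant for her role. Negation swaps the approximants of a
-- coalition with those of its opponents moving second, so by induction on φ
-- Eloise wins from (E, q, φ) iff q ⊨_f φ and from (A, q, φ) iff q ⊭_f φ.
module Submission where

open import Defs
open import Level using (0ℓ)
open import Axiom.ExcludedMiddle using (ExcludedMiddle)
open import Axiom.DoubleNegationElimination using (em⇒dne)
open import Function.Base using (_∘_; id)
open import Function.Bundles using (_⇔_; mk⇔; Equivalence)
open import Data.Nat using (ℕ; zero; suc; _≤_; _<_; z≤n; s≤s; s≤s⁻¹)
open import Data.Nat.Properties using (≤-refl; ≤-trans; n≤1+n; n≮0; ≮⇒≥; ≤∧≢⇒<)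
open import Data.Nat.Induction using (<-rec)
open import Data.Fin.Subset using (Subset; ∁)
open import Data.Bool using (Bool; true; false)
open import Data.Maybe using (Maybe; nothing; just; maybe′)
open import Data.Product using (Σ; _×_; _,_; proj₁; proj₂)
open import Data.Sum using (_⊎_; inj₁; inj₂; [_,_])
open import Data.Empty using (⊥-elim)
open import Relation.Nullary using (¬_; yes; no; Dec; does)
open import Relation.Unary using (_⊆_)
open import Relation.Binary.PropositionalEquality using (_≡_; refl; sym; subst)

open Equivalence using (to; from)

module _ (lem : ExcludedMiddle 0ℓ) where

  independence-of-premise : {I R : Set} {Q : I → Set} → I →
    (R → Σ I Q) → Σ I λ i → R → Q i
  independence-of-premise {R = R} i₀ f with lem {R}
  ... | yes r = proj₁ (f r) , λ _ → proj₂ (f r)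
  ... | no ¬r = i₀ , λ r → ⊥-elim (¬r r)

  module _ (Q : ℕ → Set) where

    HasLeast : Set
    HasLeast = Σ ℕ λ j → Q j × (∀ i → i < j → ¬ Q i)

    least : ∀ m → Q m → HasLeast
    least = <-rec (λ m → Q m → HasLeast) step
      where
      step : ∀ m → (∀ {i} → i < m → Q i → HasLeast) → Q m → HasLeast
      step m rec qm with lem {Σ ℕ λ i → i < m × Q i}
      ... | yes (i , i<m , qi) = rec i<m qi
      ... | no none = m , qm , λ i i<m qi → none (i , i<m , qi)

    ≤-pred-avoiding : ∀ {n i} → ¬ Q (suc n) → i ≤ suc n → Q i → i ≤ n
    ≤-pred-avoiding ¬qn i≤1+n qi = s≤s⁻¹ (≤∧≢⇒< i≤1+n λ { refl → ¬qn qi })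

    greatest : ∀ n j → j ≤ n → Q j →
      Σ ℕ λ r → r ≤ n × Q r × (∀ i → i ≤ n → Q i → i ≤ r)
    greatest n j j≤n qj with lem {Q n}
    ... | yes qn = n , ≤-refl , qn , λ _ i≤n _ → i≤n
    greatest zero zero z≤n qj | no ¬qn = ⊥-elim (¬qn qj)
    greatest (suc n) j j≤1+n qj | no ¬qn with greatest n j (≤-pred-avoiding ¬qn j≤1+n qj) qj
    ... | r , r≤n , qr , maximal =
      r , ≤-trans r≤n (n≤1+n n) , qr ,
      λ i i≤1+n qi → maximal i (≤-pred-avoiding ¬qn i≤1+n qi) qi

  dne : {P : Set} → ¬ ¬ P → P
  dne = em⇒dne lem

  module Game (M : CGM) where
    open CGM M

    someTuple : (B : Subset k) (x : St) → Tuple M B x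
    someTuple B x i _ = d-ne i x

    someMove : (mine : Bool) (B : Subset k) (x : St) → StepMove M mine B x
    someMove true B x = someTuple B x
    someMove false B x _ = someTuple (∁ B) x

    positional : {B : Subset k} → ((x : St) → Tuple M B x) → CStrat M B
    positional f i i∈B x = f x i i∈B

    StepAll-map : ∀ mine {B x mv} {K K′ : St → Set} → K ⊆ K′ →
      StepAll M mine B x mv K → StepAll M mine B x mv K′
    StepAll-map true f h β = f (h β)
    StepAll-map false f h α = f (h α)

    CPre : Bool → Subset k → (St → Set) → St → Set
    CPre mine B K x = Σ (StepMove M mine B x) λ mv → StepAll M mine B x mv K

    CPre-map : ∀ mine {B x} {K K′ : St → Set} → K ⊆ K′ →
      CPre mine B K x → CPre mine B K′ x
    CPre-map mine f (mv , h) = mv , StepAll-map mine f h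

    ¬CPre⇔CPre : ∀ {B x} (K : St → Set) →
      (¬ CPre true B K x) ⇔ CPre false B (λ y → ¬ K y) x
    ¬CPre⇔CPre {B} {x} K = mk⇔
      (λ ¬c → (λ α → proj₁ (refute ¬c α)) , λ α → proj₂ (refute ¬c α))
      (λ (f , h) (α , g) → h α (g (f α)))
      where
      refute : ¬ CPre true B K x → (α : Tuple M B x) →
        Σ (Tuple M (∁ B) x) λ β → ¬ K (o x (merge M B x α β))
      refute ¬c α with lem {Σ (Tuple M (∁ B) x) λ β → ¬ K (o x (merge M B x α β))}
      ... | yes r = r
      ... | no none = ⊥-elim (¬c (α , λ β → dne λ ¬k → none (β , ¬k)))

    -- With mine = false a move is a response function of the complement of B:
    -- Reach false B and Safe false B are the approximants for the opponents of
    -- B, who choose their actions after seeing those of B.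
    Reach : Bool → Subset k → (T P : St → Set) → ℕ → St → Set
    Reach mine B T P zero x = T x
    Reach mine B T P (suc m) x = T x ⊎ (P x × CPre mine B (Reach mine B T P m) x)

    Safe : Bool → Subset k → (T P : St → Set) → ℕ → St → Set
    Safe mine B T P zero x = T x
    Safe mine B T P (suc m) x = T x × (P x ⊎ CPre mine B (Safe mine B T P m) x)

    Safe⇒now : ∀ {mine B T P} m {x} → Safe mine B T P m x → T x
    Safe⇒now zero t = t
    Safe⇒now (suc m) (t , _) = t

    module _ {B : Subset k} {T P : St → Set} where

      ¬Reach⇔Safe : ∀ m {x} → (¬ Reach true B T P m x) ⇔
        Safe false B (λ y → ¬ T y) (λ y → ¬ P y) m x
      ¬Reach⇔Safe zero = mk⇔ id id
      ¬Reach⇔Safe (suc m) {x} = mk⇔ forward backward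
        where
        forward : ¬ Reach true B T P (suc m) x →
          Safe false B (λ y → ¬ T y) (λ y → ¬ P y) (suc m) x
        forward ¬r with lem {P x}
        ... | no ¬p = (¬r ∘ inj₁) , inj₁ ¬p
        ... | yes p = (¬r ∘ inj₁) , inj₂ (CPre-map false (λ {y} → to (¬Reach⇔Safe m {y}))
          (to (¬CPre⇔CPre (Reach true B T P m)) λ c → ¬r (inj₂ (p , c))))
        backward : Safe false B (λ y → ¬ T y) (λ y → ¬ P y) (suc m) x →
          ¬ Reach true B T P (suc m) x
        backward (¬t , _) (inj₁ t) = ¬t t
        backward (_ , inj₁ ¬p) (inj₂ (p , _)) = ¬p p
        backward (_ , inj₂ c) (inj₂ (_ , c′)) = from (¬CPre⇔CPre (Reach true B T P m))
          (CPre-map false (λ {y} → from (¬Reach⇔Safe m {y})) c) c′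

      ¬Safe⇔Reach : ∀ m {x} → (¬ Safe true B T P m x) ⇔
        Reach false B (λ y → ¬ T y) (λ y → ¬ P y) m x
      ¬Safe⇔Reach zero = mk⇔ id id
      ¬Safe⇔Reach (suc m) {x} = mk⇔ forward backward
        where
        forward : ¬ Safe true B T P (suc m) x →
          Reach false B (λ y → ¬ T y) (λ y → ¬ P y) (suc m) x
        forward ¬s with lem {T x}
        ... | no ¬t = inj₁ ¬t
        ... | yes t = inj₂ ((λ p → ¬s (t , inj₁ p)) ,
          CPre-map false (λ {y} → to (¬Safe⇔Reach m {y}))
            (to (¬CPre⇔CPre (Safe true B T P m)) λ c → ¬s (t , inj₂ c)))
        backward : Reach false B (λ y → ¬ T y) (λ y → ¬ P y) (suc m) x →
          ¬ Safe true B T P (suc m) x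
        backward (inj₁ ¬t) (t , _) = ¬t t
        backward (inj₂ (¬p , _)) (_ , inj₁ p) = ¬p p
        backward (inj₂ (_ , c)) (_ , inj₂ c′) = from (¬CPre⇔CPre (Safe true B T P m))
          (CPre-map false (λ {y} → from (¬Safe⇔Reach m {y})) c) c′

    module Embedded (mine : Bool) (B : Subset k) (T P : St → Set) where

      reachMove : ∀ m x → Σ (Maybe (StepMove M mine B x)) λ r →
        Reach mine B T P (suc m) x →
        maybe′ (λ mv → P x × StepAll M mine B x mv (Reach mine B T P m)) (T x) r
      reachMove m x with lem {P x × CPre mine B (Reach mine B T P m) x}
      ... | yes (p , mv , h) = just mv , λ _ → p , h
      ... | no ¬pc = nothing , [ id , (λ pc → ⊥-elim (¬pc pc)) ]

      reachStrategy : EmbStrat M mine B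
      reachStrategy zero _ = nothing
      reachStrategy (suc m) x = proj₁ (reachMove m x)

      reach⇒EmbWin : {Kc Kn : St → Set} → T ⊆ Kc → P ⊆ Kn →
        ∀ m {x} → Reach mine B T P m x → EmbWin M true mine B reachStrategy Kc Kn m x
      reach⇒EmbWin T⊆Kc P⊆Kn zero t = T⊆Kc t
      reach⇒EmbWin T⊆Kc P⊆Kn (suc m) {x} r with reachMove m x
      ... | nothing , spec = T⊆Kc (spec r)
      ... | just mv , spec =
        P⊆Kn (proj₁ (spec r)) , StepAll-map mine (reach⇒EmbWin T⊆Kc P⊆Kn m) (proj₂ (spec r))

      EmbWin⇒reach : {Kc Kn : St → Set} (s : EmbStrat M mine B) →
        Kc ⊆ T → Kn ⊆ P →
        ∀ m {x} → EmbWin M true mine B s Kc Kn m x → Reach mine B T P m x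
      EmbWin⇒reach s Kc⊆T Kn⊆P zero w = Kc⊆T w
      EmbWin⇒reach s Kc⊆T Kn⊆P (suc m) {x} w with s (suc m) x
      ... | nothing = inj₁ (Kc⊆T w)
      ... | just mv = inj₂ (Kn⊆P (proj₁ w) , mv ,
                            StepAll-map mine (EmbWin⇒reach s Kc⊆T Kn⊆P m) (proj₂ w))

      safeMove : ∀ m x → Σ (Maybe (StepMove M mine B x)) λ r →
        Safe mine B T P (suc m) x →
        maybe′ (λ mv → StepAll M mine B x mv (Safe mine B T P m)) (P x) r
      safeMove m x with lem {CPre mine B (Safe mine B T P m) x}
      ... | yes (mv , h) = just mv , λ _ → h
      ... | no ¬c = nothing , λ (_ , pc) → [ id , (λ c → ⊥-elim (¬c c)) ] pc

      safeStrategy : EmbStrat M mine B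
      safeStrategy zero _ = nothing
      safeStrategy (suc m) x = proj₁ (safeMove m x)

      safe⇒EmbWin : {Kc Kn : St → Set} → T ⊆ Kc → P ⊆ Kn →
        ∀ m {x} → Safe mine B T P m x → EmbWin M false mine B safeStrategy Kc Kn m x
      safe⇒EmbWin T⊆Kc P⊆Kn zero t = T⊆Kc t
      safe⇒EmbWin T⊆Kc P⊆Kn (suc m) {x} s with safeMove m x
      ... | nothing , spec = T⊆Kc (proj₁ s) , P⊆Kn (spec s)
      ... | just mv , spec =
        T⊆Kc (proj₁ s) , StepAll-map mine (safe⇒EmbWin T⊆Kc P⊆Kn m) (spec s)

      EmbWin⇒safe : {Kc Kn : St → Set} (s : EmbStrat M mine B) →
        Kc ⊆ T → Kn ⊆ P →
        ∀ m {x} → EmbWin M false mine B s Kc Kn m x → Safe mine B T P m x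
      EmbWin⇒safe s Kc⊆T Kn⊆P zero w = Kc⊆T w
      EmbWin⇒safe s Kc⊆T Kn⊆P (suc m) {x} w with s (suc m) x
      ... | nothing = Kc⊆T (proj₁ w) , inj₁ (Kn⊆P (proj₂ w))
      ... | just mv = Kc⊆T (proj₁ w) ,
                      inj₂ (mv , StepAll-map mine (EmbWin⇒safe s Kc⊆T Kn⊆P m) (proj₂ w))

    cons : St → (ℕ → St) → ℕ → St
    cons x Λ zero = x
    cons x Λ (suc t) = Λ t

    module _ {B : Subset k} (S : CStrat M B) where

      successor : (x : St) → Tuple M (∁ B) x → St
      successor x β = o x (merge M B x (atState M S x) β)

      somePath : St → ℕ → St
      somePath x zero = x
      somePath x (suc t) = successor (somePath x t) (someTuple (∁ B) (somePath x t))

      somePath-isPath : ∀ x → IsPath M x S (somePath x)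
      somePath-isPath x = refl , λ t → someTuple (∁ B) (somePath x t) , refl

      cons-isPath : ∀ {x β Λ} → IsPath M (successor x β) S Λ → IsPath M x S (cons x Λ)
      cons-isPath {β = β} (Λ₀ , steps) = refl , λ { zero → β , Λ₀ ; (suc t) → steps t }

      tail-isPath : ∀ {x Λ} → IsPath M x S Λ →
        Σ (Tuple M (∁ B) x) λ β → IsPath M (successor x β) S (Λ ∘ suc)
      tail-isPath (refl , steps) = proj₁ (steps 0) , proj₂ (steps 0) , steps ∘ suc

      Next : (St → Set) → St → Set
      Next K x = (Λ : ℕ → St) → IsPath M x S Λ → K (Λ 1)

      Next⇔StepAll : ∀ {K x} → Next K x ⇔ StepAll M true B x (atState M S x) K
      Next⇔StepAll {K} = mk⇔
        (λ h β → h (cons _ (somePath (successor _ β))) (cons-isPath (somePath-isPath _)))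
        (λ h Λ path → let (β , Λ₁ , _) = tail-isPath path in subst K (sym Λ₁) (h β))

      module _ (T P : St → Set) where

        Until : ℕ → St → Set
        Until n x = (Λ : ℕ → St) → IsPath M x S Λ →
          Σ ℕ λ i → (i ≤ n) × T (Λ i) × ((j : ℕ) → j < i → P (Λ j))

        Release : ℕ → St → Set
        Release n x = (Λ : ℕ → St) → IsPath M x S Λ →
          (i : ℕ) → i ≤ n → T (Λ i) ⊎ (Σ ℕ λ j → (j < i) × P (Λ j))

        Until-now : ∀ {n x} → T x → Until n x
        Until-now t Λ (refl , _) = 0 , z≤n , t , λ _ ()

        Until⇒now : ∀ {x} → Until 0 x → T x
        Until⇒now {x} h with h (somePath x) (somePath-isPath x)
        ... | zero , _ , t , _ = t

        Until-suc : ∀ {n x} → T x ⊎ (P x × StepAll M true B x (atState M S x) (Until n)) →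
          Until (suc n) x
        Until-suc (inj₁ t) = Until-now t
        Until-suc (inj₂ (p , later)) Λ path@(refl , _) with tail-isPath path
        ... | β , tail with later β (Λ ∘ suc) tail
        ...   | i , i≤n , t , ps = suc i , s≤s i≤n , t , λ where
          zero _ → p
          (suc j) j<1+i → ps j (s≤s⁻¹ j<1+i)

        Until-suc⁻ : ∀ {n x} → Until (suc n) x →
          T x ⊎ (P x × StepAll M true B x (atState M S x) (Until n))
        Until-suc⁻ {n} {x} h with lem {T x}
        ... | yes t = inj₁ t
        ... | no ¬t = inj₂ (P-now , later)
          where
          P-now : P x
          P-now with h (somePath x) (somePath-isPath x)
          ... | zero , _ , t , _ = ⊥-elim (¬t t)
          ... | suc i , _ , _ , ps = ps 0 (s≤s z≤n)
          later : StepAll M true B x (atState M S x) (Until n)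
          later β Λ path with h (cons x Λ) (cons-isPath path)
          ... | zero , _ , t , _ = ⊥-elim (¬t t)
          ... | suc i , 1+i≤1+n , t , ps =
            i , s≤s⁻¹ 1+i≤1+n , t , λ j j<i → ps (suc j) (s≤s j<i)

        Release⇒now : ∀ {n x} → Release n x → T x
        Release⇒now {x = x} h with h (somePath x) (somePath-isPath x) 0 z≤n
        ... | inj₁ t = t

        Release-now : ∀ {x} → T x → Release 0 x
        Release-now t Λ (refl , _) zero z≤n = inj₁ t

        Release-suc : ∀ {n x} → T x × (P x ⊎ StepAll M true B x (atState M S x) (Release n)) →
          Release (suc n) x
        Release-suc (t , _) Λ (refl , _) zero _ = inj₁ t
        Release-suc (_ , inj₁ p) Λ (refl , _) (suc i) _ = inj₂ (0 , s≤s z≤n , p)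
        Release-suc (_ , inj₂ later) Λ path (suc i) (s≤s i≤n) with tail-isPath path
        ... | β , tail with later β (Λ ∘ suc) tail i i≤n
        ...   | inj₁ t = inj₁ t
        ...   | inj₂ (j , j<i , pj) = inj₂ (suc j , s≤s j<i , pj)

        Release-suc⁻ : ∀ {n x} → Release (suc n) x →
          T x × (P x ⊎ StepAll M true B x (atState M S x) (Release n))
        Release-suc⁻ {n} {x} h with lem {P x}
        ... | yes p = Release⇒now h , inj₁ p
        ... | no ¬p = Release⇒now h , inj₂ later
          where
          later : StepAll M true B x (atState M S x) (Release n)
          later β Λ path i i≤n with h (cons x Λ) (cons-isPath path) (suc i) (s≤s i≤n)
          ... | inj₁ t = inj₁ t
          ... | inj₂ (zero , _ , p) = ⊥-elim (¬p p)
          ... | inj₂ (suc j , 1+j<1+i , pj) = inj₂ (j , s≤s⁻¹ 1+j<1+i , pj)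

    module _ {B : Subset k} (q : St) (α : Tuple M B q) where

      private
        moveAt : (x : St) → Dec (x ≡ q) → Tuple M B x
        moveAt x (yes refl) = α
        moveAt x (no _) = someTuple B x

        moveAt-self : ∀ {K} x (x≟q : Dec (x ≡ q)) → x ≡ q →
          StepAll M true B q α K → StepAll M true B x (moveAt x x≟q) K
        moveAt-self x (yes refl) _ h = h
        moveAt-self x (no x≢q) x≡q _ = ⊥-elim (x≢q x≡q)

      playingAt : CStrat M B
      playingAt = positional λ x → moveAt x lem

      playingAt-plays : ∀ {K} → StepAll M true B q α K →
        StepAll M true B q (atState M playingAt q) K
      playingAt-plays {K} = moveAt-self {K} q lem refl

    Next⇔CPre : ∀ {B x} (K : St → Set) → (Σ (CStrat M B) λ S → Next S K x) ⇔ CPre true B K x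
    Next⇔CPre {x = x} K = mk⇔
      (λ (S , h) → atState M S x , to (Next⇔StepAll S {K}) h)
      (λ (α , h) → playingAt x α ,
                   from (Next⇔StepAll (playingAt x α) {K}) (playingAt-plays x α {K} h))

    module _ (B : Subset k) (T P : St → Set) where

      untilMove : (x : St) → Σ (Tuple M B x) λ α → ∀ m → Reach true B T P m x →
        T x ⊎ Σ ℕ λ r → (suc r ≤ m) × P x × StepAll M true B x α (Reach true B T P r)
      untilMove x with lem {Σ ℕ λ m → Reach true B T P m x}
      ... | no unreachable = someTuple B x , λ m r → ⊥-elim (unreachable (m , r))
      ... | yes (m , r) with least (λ j → Reach true B T P j x) m r
      ...   | zero , t , _ = someTuple B x , λ _ _ → inj₁ t
      ...   | suc _ , inj₁ t , _ = someTuple B x , λ _ _ → inj₁ t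
      ...   | suc rank , inj₂ (p , α , h) , minimal =
        α , λ m′ r′ → inj₂ (rank , ≮⇒≥ (λ m′<rank → minimal m′ m′<rank r′) , p , h)

      untilStrategy : CStrat M B
      untilStrategy = positional (proj₁ ∘ untilMove)

      Reach⇒Until : ∀ n m {x} → m ≤ n → Reach true B T P m x → Until untilStrategy T P n x
      Reach⇒Until n m {x} m≤n r with proj₂ (untilMove x) m r
      ... | inj₁ t = Until-now untilStrategy T P t
      Reach⇒Until zero m m≤n r | inj₂ (rank , 1+rank≤m , _) =
        ⊥-elim (n≮0 (≤-trans 1+rank≤m m≤n))
      Reach⇒Until (suc n) m m≤n r | inj₂ (rank , 1+rank≤m , p , h) =
        Until-suc untilStrategy T P (inj₂ (p , λ β →
          Reach⇒Until n rank (s≤s⁻¹ (≤-trans 1+rank≤m m≤n)) (h β)))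

      Until⇒Reach : ∀ (S : CStrat M B) n {x} → Until S T P n x → Reach true B T P n x
      Until⇒Reach S zero h = Until⇒now S T P h
      Until⇒Reach S (suc n) {x} h with Until-suc⁻ S T P h
      ... | inj₁ t = inj₁ t
      ... | inj₂ (p , later) = inj₂ (p , atState M S x , λ β → Until⇒Reach S n (later β))

      Until⇔Reach : ∀ n {x} → (Σ (CStrat M B) λ S → Until S T P n x) ⇔ Reach true B T P n x
      Until⇔Reach n = mk⇔ (λ (S , h) → Until⇒Reach S n h)
                          (λ r → untilStrategy , Reach⇒Until n n ≤-refl r)

      releaseMove : (n : ℕ) (x : St) → Σ (Tuple M B x) λ α →
        ∀ m → suc m ≤ n → Safe true B T P (suc m) x →
        P x ⊎ Σ ℕ λ r → (m ≤ r) × (r ≤ n) × StepAll M true B x α (Safe true B T P r)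
      releaseMove n x with lem {Σ ℕ λ m → suc m ≤ n × Safe true B T P (suc m) x}
      ... | no unsafe = someTuple B x , λ m 1+m≤n s → ⊥-elim (unsafe (m , 1+m≤n , s))
      ... | yes (m , 1+m≤n , s) with greatest (λ j → Safe true B T P j x) n (suc m) 1+m≤n s
      ...   | zero , _ , _ , maximal =
        someTuple B x , λ _ _ _ → ⊥-elim (n≮0 (maximal (suc m) 1+m≤n s))
      ...   | suc _ , _ , (_ , inj₁ p) , _ = someTuple B x , λ _ _ _ → inj₁ p
      ...   | suc rank , 1+rank≤n , (_ , inj₂ (α , h)) , maximal =
        α , λ m′ 1+m′≤n s′ → inj₂ (rank , s≤s⁻¹ (maximal (suc m′) 1+m′≤n s′) ,
                                   ≤-trans (n≤1+n rank) 1+rank≤n , h)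

      releaseStrategy : ℕ → CStrat M B
      releaseStrategy n = positional (proj₁ ∘ releaseMove n)

      Safe⇒Release : ∀ n b m {x} → b ≤ m → m ≤ n → Safe true B T P m x →
        Release (releaseStrategy n) T P b x
      Safe⇒Release n zero m _ _ s = Release-now (releaseStrategy n) T P (Safe⇒now m s)
      Safe⇒Release n (suc b) (suc m) {x} (s≤s b≤m) 1+m≤n s
        with proj₂ (releaseMove n x) m 1+m≤n s
      ... | inj₁ p = Release-suc (releaseStrategy n) T P (proj₁ s , inj₁ p)
      ... | inj₂ (r , m≤r , r≤n , h) = Release-suc (releaseStrategy n) T P
        (proj₁ s , inj₂ λ β → Safe⇒Release n b r (≤-trans b≤m m≤r) r≤n (h β))

      Release⇒Safe : ∀ (S : CStrat M B) n {x} → Release S T P n x → Safe true B T P n x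
      Release⇒Safe S zero h = Release⇒now S T P h
      Release⇒Safe S (suc n) {x} h with Release-suc⁻ S T P h
      ... | t , inj₁ p = t , inj₁ p
      ... | t , inj₂ later = t , inj₂ (atState M S x , λ β → Release⇒Safe S n (later β))

      Release⇔Safe : ∀ n {x} → (Σ (CStrat M B) λ S → Release S T P n x) ⇔ Safe true B T P n x
      Release⇔Safe n = mk⇔ (λ (S , h) → Release⇒Safe S n h)
                           (λ s → releaseStrategy n , Safe⇒Release n n n ≤-refl ≤-refl s)

    Truth : Player → Formula M → St → Set
    Truth E φ q = Sat M q φ
    Truth A φ q = ¬ Sat M q φ

    module _ {q : St} {B : Subset k} where

      Truth-X : ∀ P {φ} → Truth P (⟪ B ⟫X φ) q ⇔ CPre (isE P) B (Truth P φ) q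
      Truth-X E {φ} = Next⇔CPre (Truth E φ)
      Truth-X A {φ} = mk⇔
        (λ ¬s → to (¬CPre⇔CPre (Truth E φ)) (¬s ∘ from (Next⇔CPre (Truth E φ))))
        (λ c s → from (¬CPre⇔CPre (Truth E φ)) c (to (Next⇔CPre (Truth E φ)) s))

      module _ {ψ θ : Formula M} where

        Truth-U-E : Sat M q (⟪ B ⟫ ψ U θ) ⇔ Σ ℕ λ n → Reach true B (Truth E θ) (Truth E ψ) n q
        Truth-U-E = mk⇔ (λ (n , u) → n , to (Until⇔Reach B _ _ n) u)
                        (λ (n , r) → n , from (Until⇔Reach B _ _ n) r)

        Truth-U-A : (¬ Sat M q (⟪ B ⟫ ψ U θ)) ⇔
          ((n : ℕ) → Safe false B (Truth A θ) (Truth A ψ) n q)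
        Truth-U-A = mk⇔
          (λ ¬s n → to (¬Reach⇔Safe n) λ r → ¬s (n , from (Until⇔Reach B _ _ n) r))
          (λ h (n , u) → from (¬Reach⇔Safe n) (h n) (to (Until⇔Reach B _ _ n) u))

        Truth-R-E : Sat M q (⟪ B ⟫ ψ R θ) ⇔ ((n : ℕ) → Safe true B (Truth E θ) (Truth E ψ) n q)
        Truth-R-E = mk⇔ (λ h n → to (Release⇔Safe B _ _ n) (h n))
                        (λ h n → from (Release⇔Safe B _ _ n) (h n))

        Truth-R-A : (¬ Sat M q (⟪ B ⟫ ψ R θ)) ⇔
          Σ ℕ λ n → Reach false B (Truth A θ) (Truth A ψ) n q
        Truth-R-A = mk⇔
          (λ ¬s → dne λ none → ¬s λ n → from (Release⇔Safe B _ _ n)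
                    (dne λ ¬safe → none (n , to (¬Safe⇔Reach n) ¬safe)))
          (λ (n , r) h → from (¬Safe⇔Reach n) r (to (Release⇔Safe B _ _ n) (h n)))

    nextMove : ∀ P q B φ → Σ (StepMove M (isE P) B q) λ mv →
      Truth P (⟪ B ⟫X φ) q → StepAll M (isE P) B q mv (Truth P φ)
    nextMove P q B φ = independence-of-premise (someMove (isE P) B q) (to (Truth-X P))

    untilBound : ∀ q B ψ θ → Σ ℕ λ n →
      Sat M q (⟪ B ⟫ ψ U θ) → Reach true B (Truth E θ) (Truth E ψ) n q
    untilBound q B ψ θ = independence-of-premise 0 (to (Truth-U-E {ψ = ψ} {θ}))

    releaseBound : ∀ q B ψ θ → Σ ℕ λ n →
      ¬ Sat M q (⟪ B ⟫ ψ R θ) → Reach false B (Truth A θ) (Truth A ψ) n q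
    releaseBound q B ψ θ = independence-of-premise 0 (to (Truth-R-A {ψ = ψ} {θ}))

    open Embedded

    truthStrategy : EStrat M
    truthStrategy P q (atom p) = true
    truthStrategy P q (¬' φ) = true
    truthStrategy E q (φ ∨' ψ) = does (lem {Sat M q φ})
    truthStrategy A q (φ ∨' ψ) = true
    truthStrategy P q (⟪ B ⟫X φ) = proj₁ (nextMove P q B φ)
    truthStrategy E q (⟪ B ⟫ ψ U θ) =
      proj₁ (untilBound q B ψ θ) , reachStrategy true B (Truth E θ) (Truth E ψ)
    truthStrategy A q (⟪ B ⟫ ψ U θ) _ = safeStrategy false B (Truth A θ) (Truth A ψ)
    truthStrategy E q (⟪ B ⟫ ψ R θ) _ = safeStrategy true B (Truth E θ) (Truth E ψ)
    truthStrategy A q (⟪ B ⟫ ψ R θ) =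
      proj₁ (releaseBound q B ψ θ) , reachStrategy false B (Truth A θ) (Truth A ψ)

    truthStrategy-wins : ∀ P φ {q} → Truth P φ q → EWins M truthStrategy P q φ
    truthStrategy-wins E (atom p) t = t
    truthStrategy-wins A (atom p) t = t
    truthStrategy-wins E (¬' φ) t = truthStrategy-wins A φ t
    truthStrategy-wins A (¬' φ) t = truthStrategy-wins E φ (dne t)
    truthStrategy-wins E (φ ∨' ψ) {q} t with lem {Sat M q φ}
    ... | yes tφ = truthStrategy-wins E φ tφ
    ... | no ¬tφ = truthStrategy-wins E ψ ([ ⊥-elim ∘ ¬tφ , id ] t)
    truthStrategy-wins A (φ ∨' ψ) t =
      truthStrategy-wins A φ (t ∘ inj₁) , truthStrategy-wins A ψ (t ∘ inj₂)
    truthStrategy-wins E (⟪ B ⟫X φ) {q} t =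
      λ β → truthStrategy-wins E φ (proj₂ (nextMove E q B φ) t β)
    truthStrategy-wins A (⟪ B ⟫X φ) {q} t =
      λ α → truthStrategy-wins A φ (proj₂ (nextMove A q B φ) t α)
    truthStrategy-wins E (⟪ B ⟫ ψ U θ) {q} t =
      reach⇒EmbWin true B (Truth E θ) (Truth E ψ) (truthStrategy-wins E θ) (truthStrategy-wins E ψ)
        (proj₁ (untilBound q B ψ θ)) (proj₂ (untilBound q B ψ θ) t)
    truthStrategy-wins A (⟪ B ⟫ ψ U θ) t n =
      safe⇒EmbWin false B (Truth A θ) (Truth A ψ) (truthStrategy-wins A θ) (truthStrategy-wins A ψ) n
        (to (Truth-U-A {ψ = ψ} {θ}) t n)
    truthStrategy-wins E (⟪ B ⟫ ψ R θ) t n =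
      safe⇒EmbWin true B (Truth E θ) (Truth E ψ) (truthStrategy-wins E θ) (truthStrategy-wins E ψ) n
        (to (Truth-R-E {ψ = ψ} {θ}) t n)
    truthStrategy-wins A (⟪ B ⟫ ψ R θ) {q} t =
      reach⇒EmbWin false B (Truth A θ) (Truth A ψ) (truthStrategy-wins A θ) (truthStrategy-wins A ψ)
        (proj₁ (releaseBound q B ψ θ)) (proj₂ (releaseBound q B ψ θ) t)

    EWins⇒Truth : ∀ σ P φ {q} → EWins M σ P q φ → Truth P φ q
    EWins⇒Truth σ E (atom p) w = w
    EWins⇒Truth σ A (atom p) w = w
    EWins⇒Truth σ E (¬' φ) w = EWins⇒Truth σ A φ w
    EWins⇒Truth σ A (¬' φ) w ¬s = ¬s (EWins⇒Truth σ E φ w)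
    EWins⇒Truth σ E (φ ∨' ψ) {q} w with σ E q (φ ∨' ψ)
    ... | true = inj₁ (EWins⇒Truth σ E φ w)
    ... | false = inj₂ (EWins⇒Truth σ E ψ w)
    EWins⇒Truth σ A (φ ∨' ψ) (wφ , wψ) = [ EWins⇒Truth σ A φ wφ , EWins⇒Truth σ A ψ wψ ]
    EWins⇒Truth σ E (⟪ B ⟫X φ) {q} w =
      from (Truth-X E {φ}) (σ E q (⟪ B ⟫X φ) , λ β → EWins⇒Truth σ E φ (w β))
    EWins⇒Truth σ A (⟪ B ⟫X φ) {q} w =
      from (Truth-X A {φ}) (σ A q (⟪ B ⟫X φ) , λ α → EWins⇒Truth σ A φ (w α))
    EWins⇒Truth σ E (⟪ B ⟫ ψ U θ) {q} w with σ E q (⟪ B ⟫ ψ U θ)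
    ... | n , s = from (Truth-U-E {ψ = ψ} {θ}) (n ,
      EmbWin⇒reach true B (Truth E θ) (Truth E ψ) s (EWins⇒Truth σ E θ) (EWins⇒Truth σ E ψ) n w)
    EWins⇒Truth σ A (⟪ B ⟫ ψ U θ) {q} w = from (Truth-U-A {ψ = ψ} {θ}) λ n →
      EmbWin⇒safe false B (Truth A θ) (Truth A ψ) (σ A q (⟪ B ⟫ ψ U θ) n)
        (EWins⇒Truth σ A θ) (EWins⇒Truth σ A ψ) n (w n)
    EWins⇒Truth σ E (⟪ B ⟫ ψ R θ) {q} w = from (Truth-R-E {ψ = ψ} {θ}) λ n →
      EmbWin⇒safe true B (Truth E θ) (Truth E ψ) (σ E q (⟪ B ⟫ ψ R θ) n)
        (EWins⇒Truth σ E θ) (EWins⇒Truth σ E ψ) n (w n)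
    EWins⇒Truth σ A (⟪ B ⟫ ψ R θ) {q} w with σ A q (⟪ B ⟫ ψ R θ)
    ... | n , s = from (Truth-R-A {ψ = ψ} {θ}) (n ,
      EmbWin⇒reach false B (Truth A θ) (Truth A ψ) s (EWins⇒Truth σ A θ) (EWins⇒Truth σ A ψ) n w)

theorem5p6 : ExcludedMiddle 0ℓ →
    (M : CGM) (qin : CGM.St M) (φ : Formula M) →
    Sat M qin φ ⇔ GSat M qin φ
theorem5p6 lem M qin φ = mk⇔
  (λ t → truthStrategy , truthStrategy-wins E φ t)
  (λ (σ , w) → EWins⇒Truth σ E φ w)
  where open Game lem M
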